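{- The structure $\mathcal{F}^f = (X^f,\le^f,R^f)$ is a Kripke frame, i.e. $\le^f$ is a preorder and $({\ge}^f \circ R^f \circ {\ge}^f) \subseteq R^f$.
   Context: IntGC is the logic over intuitionistic propositional logic with additional unary connectives $\vartriangle$, $\triangledown$, closed under substitution, modus ponens and the rules: $A \to \triangledown B$ provable iff $\vartriangle A \to B$ provable. A Kripke frame $(X,\le,R)$ has $\le$ a preorder and $R$ a relation with $({\ge}\circ R\circ{\ge})\subseteq R$; in a model, satisfaction is intuitionistic for $\neg,\to,\vee,\wedge$, and $x \models \vartriangle A$ iff some $y$ has $x\,R\,y$ and $y\models A$; $x\models \triangledown A$ iff every $y$ with $y\,R\,x$ satisfies $A$. Fix a formula $A$ and such a model on $X$. Let $\Gamma = \mathrm{Sub}(A) \cup \{ \triangledown \vartriangle B \mid \vartriangle B \in \mathrm{Sub}(A) \} \cup \{ \vartriangle \triangledown B \mid \triangledown B \in \mathrm{Sub}(A) \}$ and $\Sigma = \mathrm{Sub}(A) \cup \{ (\triangledown \vartriangle)^n \triangledown B , \vartriangle (\triangledown \vartriangle)^n \triangledown B \mid n \geq 0, \triangledown B \in \Gamma \} \cup \{ (\vartriangle \triangledown)^n \vartriangle B , \triangledown (\vartriangle \triangledown)^n \vartriangle B \mid n \geq 0, \vartriangle B \in \Gamma \}$. Define $x \sim y$ iff for every $B \in \Sigma$, $x \models B$ iff $y \models B$; $[x]$ is the class of $x$ and $X^f = X/{\sim}$. Define $[x] \le^f [y]$ iff for all $B\in\Sigma$, $x\models B$ implies $y \models B$;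 and $[x]\,R^f\,[y]$ iff for all $B\in\Sigma$, if $\triangledown B\in\Sigma$ and $y\models\triangledown B$ then $x\models B$. -}

module Defs where

open import Data.Nat using (ℕ; zero; suc)
open import Data.Empty using (⊥)
open import Data.Product using (Σ; _×_; _,_)
open import Data.Sum using (_⊎_)
open import Relation.Binary.PropositionalEquality using (_≡_)

infixr 6 _∧'_
infixr 5 _∨'_
infixr 4 _⇒_

data Fm : Set where
  var  : ℕ → Fm
  ¬'_  : Fm → Fm
  _∧'_ : Fm → Fm → Fm
  _∨'_ : Fm → Fm → Fm
  _⇒_  : Fm → Fm → Fm
  △_   : Fm → Fm
  ▽_   : Fm → Fm

data _∈Sub_ : Fm → Fm → Set where
  here  : ∀ {A} → A ∈Sub A
  in¬   : ∀ {B A} → B ∈Sub A → B ∈Sub (¬' A)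
  in∧ˡ  : ∀ {B A C} → B ∈Sub A → B ∈Sub (A ∧' C)
  in∧ʳ  : ∀ {B A C} → B ∈Sub C → B ∈Sub (A ∧' C)
  in∨ˡ  : ∀ {B A C} → B ∈Sub A → B ∈Sub (A ∨' C)
  in∨ʳ  : ∀ {B A C} → B ∈Sub C → B ∈Sub (A ∨' C)
  in⇒ˡ  : ∀ {B A C} → B ∈Sub A → B ∈Sub (A ⇒ C)
  in⇒ʳ  : ∀ {B A C} → B ∈Sub C → B ∈Sub (A ⇒ C)
  in△   : ∀ {B A} → B ∈Sub A → B ∈Sub (△ A)
  in▽   : ∀ {B A} → B ∈Sub A → B ∈Sub (▽ A)

iter : ℕ → (Fm → Fm) → Fm → Fm
iter zero    f B = B
iter (suc n) f B = f (iter n f B)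

▽△^ : ℕ → Fm → Fm
▽△^ n = iter n (λ F → ▽ (△ F))

△▽^ : ℕ → Fm → Fm
△▽^ n = iter n (λ F → △ (▽ F))

data _∈Γ_ : Fm → Fm → Set where
  sub   : ∀ {B A} → B ∈Sub A → B ∈Γ A
  ▽△sub : ∀ {B A} → (△ B) ∈Sub A → (▽ (△ B)) ∈Γ A
  △▽sub : ∀ {B A} → (▽ B) ∈Sub A → (△ (▽ B)) ∈Γ A

data _∈Σ_ : Fm → Fm → Set where
  sub  : ∀ {B A} → B ∈Sub A → B ∈Σ A
  box₁ : ∀ {B A} (n : ℕ) → (▽ B) ∈Γ A → (▽△^ n (▽ B)) ∈Σ A
  box₂ : ∀ {B A} (n : ℕ) → (▽ B) ∈Γ A → (△ (▽△^ n (▽ B))) ∈Σ A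
  dia₁ : ∀ {B A} (n : ℕ) → (△ B) ∈Γ A → (△▽^ n (△ B)) ∈Σ A
  dia₂ : ∀ {B A} (n : ℕ) → (△ B) ∈Γ A → (▽ (△▽^ n (△ B))) ∈Σ A

record IsKripkeFrame {X : Set} (_≤_ : X → X → Set) (R : X → X → Set) : Set where
  field
    ≤-refl  : ∀ x → x ≤ x
    ≤-trans : ∀ x y z → x ≤ y → y ≤ z → x ≤ z
    R-comp  : ∀ x x' y' y → x' ≤ x → R x' y' → y ≤ y' → R x y

record KripkeModel : Set₁ where
  field
    X     : Set
    _≤_   : X → X → Set
    R     : X → X → Set
    frame : IsKripkeFrame _≤_ R
    V     : ℕ → X → Set
    V-mono : ∀ p x y → x ≤ y → V p x → V p y

module _ (M : KripkeModel) where
  open KripkeModel M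

  infix 3 _⊨_
  _⊨_ : X → Fm → Set
  x ⊨ var p   = V p x
  x ⊨ ¬' B    = ∀ y → x ≤ y → y ⊨ B → ⊥
  x ⊨ B ∧' C  = (x ⊨ B) × (x ⊨ C)
  x ⊨ B ∨' C  = (x ⊨ B) ⊎ (x ⊨ C)
  x ⊨ B ⇒ C   = ∀ y → x ≤ y → y ⊨ B → y ⊨ C
  x ⊨ △ B     = Σ X (λ y → R x y × (y ⊨ B))
  x ⊨ ▽ B     = ∀ y → R y x → y ⊨ B

  module Filtration (A : Fm) where
    -- x ∼ y : agreement on all formulas of Σ (the equivalence defining X^f = X/∼)
    _∼_ : X → X → Set
    x ∼ y = ∀ B → B ∈Σ A → ((x ⊨ B) → (y ⊨ B)) × ((y ⊨ B) → (x ⊨ B))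

    -- [x] ≤^f [y], stated on representatives
    _≤f_ : X → X → Set
    x ≤f y = ∀ B → B ∈Σ A → x ⊨ B → y ⊨ B

    -- [x] R^f [y], stated on representatives
    Rf : X → X → Set
    Rf x y = ∀ B → B ∈Σ A → (▽ B) ∈Σ A → y ⊨ ▽ B → x ⊨ B

module Submission where

open import Defs

lemma3p6 : (M : KripkeModel) (A : Fm) →
    IsKripkeFrame (Filtration._≤f_ M A) (Filtration.Rf M A)
lemma3p6 M A = record
  { ≤-refl  = λ x B B∈Σ x⊨B → x⊨B
  ; ≤-trans = λ x y z x≤y y≤z B B∈Σ x⊨B → y≤z B B∈Σ (x≤y B B∈Σ x⊨B)
  ; R-comp  = R-comp
  }
  where
  open Filtration M A

  -- Σ-membership of ▽B is what lets y ≤f y' transport y ⊨ ▽B to y'.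
  R-comp : ∀ x x' y' y → x' ≤f x → Rf x' y' → y ≤f y' → Rf x y
  R-comp x x' y' y x'≤x x'Ry' y≤y' B B∈Σ ▽B∈Σ y⊨▽B =
    x'≤x B B∈Σ (x'Ry' B B∈Σ ▽B∈Σ (y≤y' (▽ B) ▽B∈Σ y⊨▽B))
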